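{- Let $A\in\mathbb{C}$ with $A(A^2+4)\ne0$. For any positive even integer $n$, $$A^2\det[x\delta_{jk}-v_{j+k}(A,-1)]_{0\le j,k\le n-1}=A^2x^n-A(A^2+4)\,u_n(A,-1)u_{n-1}(A,-1)\,x^{n-1}+(A^2+4)\,u_n(A,-1)^2x^{n-2},$$ where $\delta_{jk}$ is $1$ if $j=k$ and $0$ otherwise.
   Context: For $a,b\in\mathbb{C}$, the Lucas sequences are defined by $u_0(a,b)=0$, $u_1(a,b)=1$, $v_0(a,b)=2$, $v_1(a,b)=a$, and $u_{m+1}(a,b)=au_m(a,b)-bu_{m-1}(a,b)$, $v_{m+1}(a,b)=av_m(a,b)-bv_{m-1}(a,b)$ for $m\ge1$. The convention $0^0=1$ is used. -}

module Defs where

open import Level using (Level)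
open import Algebra.Bundles using (CommutativeRing)
open import Data.Nat using (ℕ; zero; suc)
open import Data.Fin using (Fin; zero; suc; punchIn; toℕ)
open import Data.Fin.Properties using (_≟_)
open import Relation.Nullary using (yes; no)

module _ {c ℓ : Level} (R : CommutativeRing c ℓ) where
  open CommutativeRing R using (Carrier; _+_; _*_; -_; _-_; 0#; 1#)

  pow : Carrier → ℕ → Carrier
  pow x zero    = 1#
  pow x (suc m) = x * pow x m

  fromNat : ℕ → Carrier
  fromNat zero    = 0#
  fromNat (suc m) = 1# + fromNat m

  lucasU : Carrier → Carrier → ℕ → Carrier
  lucasU a b zero          = 0#
  lucasU a b (suc zero)    = 1#
  lucasU a b (suc (suc m)) = a * lucasU a b (suc m) - b * lucasU a b m

  lucasV : Carrier → Carrier → ℕ → Carrier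
  lucasV a b zero          = 1# + 1#
  lucasV a b (suc zero)    = a
  lucasV a b (suc (suc m)) = a * lucasV a b (suc m) - b * lucasV a b m

  δ : {n : ℕ} → Fin n → Fin n → Carrier
  δ j k with j ≟ k
  ... | yes _ = 1#
  ... | no  _ = 0#

  sign : ℕ → Carrier
  sign zero    = 1#
  sign (suc k) = - sign k

  sumFin : (n : ℕ) → (Fin n → Carrier) → Carrier
  sumFin zero    f = 0#
  sumFin (suc n) f = f zero + sumFin n (λ k → f (suc k))

  det : (n : ℕ) → (Fin n → Fin n → Carrier) → Carrier
  det zero    M = 1#
  det (suc n) M =
    sumFin (suc n) (λ k → sign (toℕ k) * (M zero k *
      det n (λ i j → M (suc i) (punchIn k j))))

{-# OPTIONS --safe #-}

-- The Hankel matrix (v_{j+k}) has rank two: v_{j+k} = u_j v_{k+1} + (u_{j+1} - A u_j) v_k.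
-- Multilinearity of the determinant in its rows and its vanishing on two equal rows give, for
-- any vectors U, V, W, Z,
--   det (x I - U Vᵀ - W Zᵀ) = xⁿ - (U·V + W·Z) xⁿ⁻¹ + ((U·V)(W·Z) - (U·Z)(W·V)) xⁿ⁻².
-- For even n the four inner products telescope, two indices at a time, to quadratic forms in
-- (uₙ, uₙ₊₁), and Cassini's identity u²ₙ₊₁ - A uₙ uₙ₊₁ - u²ₙ = 1 turns the coefficients into the
-- stated ones. All of this holds in any commutative ring.

module Submission where

open import Defs
open import Level using (Level; _⊔_)
open import Algebra.Bundles using (CommutativeRing)
open import Data.Nat using (ℕ; _≤_; _∸_) renaming (_+_ to _+ℕ_)
open import Data.Nat.Divisibility using (_∣_)
open import Data.Fin using (Fin; toℕ)
open import Relation.Nullary using (¬_)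

open import Data.Nat as ℕ using (zero; suc; z≤n; s≤s)
open import Data.Nat.Properties using (+-suc)
open import Data.Nat.Divisibility using (divides)
open import Data.Fin using (zero; suc; punchIn; inject₁; lift)
open import Data.Fin.Properties using (suc-injective; punchIn-injective; toℕ-inject₁) renaming (_≟_ to _≟ᶠ_)
open import Data.Fin.Induction using (<-weakInduction)
open import Data.Vec.Functional using (Vector; tail; updateAt)
open import Data.Vec.Functional.Properties using (updateAt-updates; updateAt-updateAt)
open import Data.Integer as ℤ using (ℤ; +_; -[1+_]; _⊖_; _◃_)
import Data.Integer.Properties as ℤ
open import Data.Sign using (Sign) renaming (+ to s+; - to s-)
import Data.Sign as Sign
open import Data.Maybe using (Maybe; just; nothing)
open import Data.Empty using (⊥-elim)
open import Function using (_∘_; const)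
open import Relation.Nullary using (yes; no)
open import Relation.Binary.PropositionalEquality as ≡ using (_≡_; _≢_; _≗_)
import Algebra.Solver.Ring.AlmostCommutativeRing as ACR

-- Algebra.Solver.Ring needs coefficients with decidable equality, so R gets integer
-- coefficients through the canonical map ι : ℤ → R.
module IntegerCoefficientSolver {c ℓ : Level} (R : CommutativeRing c ℓ) where
  open CommutativeRing R
  open import Algebra.Properties.Ring ring using (-‿involutive; -‿distribˡ-*; -‿distribʳ-*; -0#≈0#; -‿+-comm)
  open import Algebra.Properties.Semiring.Mult.TCOptimised semiring using (_×_; 1+×; ×-homo-+; ×1-homo-*)
  open import Algebra.Properties.CommutativeSemigroup *-commutativeSemigroup using () renaming (interchange to *-interchange)
  open import Relation.Binary.Reasoning.Setoid setoid

  ι : ℤ → Carrier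
  ι (+ n)    = n × 1#
  ι -[1+ n ] = - (suc n × 1#)

  ι-neg : ∀ z → ι (ℤ.- z) ≈ - ι z
  ι-neg (+ zero)  = sym -0#≈0#
  ι-neg (+ suc n) = refl
  ι-neg -[1+ n ]  = sym (-‿involutive _)

  1+a-[1+b]≈a-b : ∀ a b → (1# + a) - (1# + b) ≈ a - b
  1+a-[1+b]≈a-b a b = begin
    (1# + a) - (1# + b)      ≈⟨ +-cong (+-comm a 1#) (-‿+-comm 1# b) ⟨
    (a + 1#) + (- 1# + - b)  ≈⟨ +-assoc a 1# _ ⟩
    a + (1# + (- 1# + - b))  ≈⟨ +-congˡ (+-assoc 1# (- 1#) (- b)) ⟨
    a + ((1# - 1#) + - b)    ≈⟨ +-congˡ (+-congʳ (-‿inverseʳ 1#)) ⟩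
    a + (0# + - b)           ≈⟨ +-congˡ (+-identityˡ (- b)) ⟩
    a - b                    ∎

  ι-⊖ : ∀ m n → ι (m ⊖ n) ≈ m × 1# - n × 1#
  ι-⊖ m       zero    = sym (trans (+-congˡ -0#≈0#) (+-identityʳ _))
  ι-⊖ zero    (suc n) = sym (+-identityˡ _)
  ι-⊖ (suc m) (suc n) = begin
    ι (suc m ⊖ suc n)                 ≡⟨ ≡.cong ι (ℤ.[1+m]⊖[1+n]≡m⊖n m n) ⟩
    ι (m ⊖ n)                         ≈⟨ ι-⊖ m n ⟩
    m × 1# - n × 1#                   ≈⟨ 1+a-[1+b]≈a-b _ _ ⟨
    (1# + m × 1#) - (1# + n × 1#)     ≈⟨ +-cong (1+×′ m) (-‿cong (1+×′ n)) ⟨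
    suc m × 1# - suc n × 1#           ∎
    where 1+×′ = λ k → 1+× k 1#

  ι-+ : ∀ x y → ι (x ℤ.+ y) ≈ ι x + ι y
  ι-+ (+ m)    (+ n)    = ×-homo-+ 1# m n
  ι-+ (+ m)    -[1+ n ] = ι-⊖ m (suc n)
  ι-+ -[1+ m ] (+ n)    = trans (ι-⊖ n (suc m)) (+-comm _ _)
  ι-+ -[1+ m ] -[1+ n ] = begin
    - (suc (suc (m ℕ.+ n)) × 1#)         ≡⟨ ≡.cong (λ k → - (suc k × 1#)) (+-suc m n) ⟨
    - ((suc m ℕ.+ suc n) × 1#)           ≈⟨ -‿cong (×-homo-+ 1# (suc m) (suc n)) ⟩
    - (suc m × 1# + suc n × 1#)          ≈⟨ -‿+-comm _ _ ⟨
    - (suc m × 1#) + - (suc n × 1#)      ∎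

  σ : Sign → Carrier
  σ s+ = 1#
  σ s- = - 1#

  σ-* : ∀ s t → σ (s Sign.* t) ≈ σ s * σ t
  σ-* s+ t  = sym (*-identityˡ _)
  σ-* s- s+ = sym (*-identityʳ _)
  σ-* s- s- = begin
    1#               ≈⟨ -‿involutive 1# ⟨
    - - 1#           ≈⟨ -‿cong (-‿cong (*-identityʳ 1#)) ⟨
    - - (1# * 1#)    ≈⟨ -‿cong (-‿distribˡ-* 1# 1#) ⟩
    - ((- 1#) * 1#)  ≈⟨ -‿distribʳ-* (- 1#) 1# ⟩
    (- 1#) * (- 1#)  ∎

  ι-◃ : ∀ s n → ι (s ◃ n) ≈ σ s * (n × 1#)
  ι-◃ s  zero    = sym (zeroʳ _)
  ι-◃ s+ (suc n) = sym (*-identityˡ _)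
  ι-◃ s- (suc n) = trans (-‿cong (sym (*-identityˡ _))) (-‿distribˡ-* _ _)

  ι≈σ*∣∣ : ∀ z → ι z ≈ σ (ℤ.sign z) * (ℤ.∣ z ∣ × 1#)
  ι≈σ*∣∣ z = begin
    ι z                            ≡⟨ ≡.cong ι (ℤ.◃-inverse z) ⟨
    ι (ℤ.sign z ◃ ℤ.∣ z ∣)             ≈⟨ ι-◃ (ℤ.sign z) ℤ.∣ z ∣ ⟩
    σ (ℤ.sign z) * (ℤ.∣ z ∣ × 1#)      ∎

  ι-* : ∀ x y → ι (x ℤ.* y) ≈ ι x * ι y
  ι-* x y = begin
    ι (x ℤ.* y)                          ≈⟨ ι-◃ (ℤ.sign x Sign.* ℤ.sign y) (ℤ.∣ x ∣ ℕ.* ℤ.∣ y ∣) ⟩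
    σ (ℤ.sign x Sign.* ℤ.sign y) * ((ℤ.∣ x ∣ ℕ.* ℤ.∣ y ∣) × 1#)
      ≈⟨ *-cong (σ-* (ℤ.sign x) (ℤ.sign y)) (×1-homo-* ℤ.∣ x ∣ ℤ.∣ y ∣) ⟩
    (σ (ℤ.sign x) * σ (ℤ.sign y)) * ((ℤ.∣ x ∣ × 1#) * (ℤ.∣ y ∣ × 1#))
      ≈⟨ *-interchange _ _ _ _ ⟩
    (σ (ℤ.sign x) * (ℤ.∣ x ∣ × 1#)) * (σ (ℤ.sign y) * (ℤ.∣ y ∣ × 1#))
      ≈⟨ *-cong (ι≈σ*∣∣ x) (ι≈σ*∣∣ y) ⟨
    ι x * ι y                            ∎

  almostCommutativeRing : ACR.AlmostCommutativeRing c ℓ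
  almostCommutativeRing = ACR.fromCommutativeRing R

  ι-homomorphism : ℤ.+-*-rawRing ACR.-Raw-AlmostCommutative⟶ almostCommutativeRing
  ι-homomorphism = record
    { ⟦_⟧ = ι ; +-homo = ι-+ ; *-homo = ι-* ; -‿homo = ι-neg ; 0-homo = refl ; 1-homo = refl }

  ι-≟ : ∀ x y → Maybe (ι x ≈ ι y)
  ι-≟ x y with x ℤ.≟ y
  ... | yes ≡.refl = just refl
  ... | no _       = nothing

  open import Algebra.Solver.Ring ℤ.+-*-rawRing almostCommutativeRing ι-homomorphism ι-≟ public

  -- Denotes fromNat R k definitionally, whereas con (+ k) denotes the optimised k × 1#.
  :fromNat : ∀ {m} → ℕ → Polynomial m
  :fromNat zero    = con (+ 0)
  :fromNat (suc k) = con (+ 1) :+ :fromNat k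

module FiniteSums {c ℓ : Level} (R : CommutativeRing c ℓ) where
  open CommutativeRing R hiding (zero)
  open import Algebra.Properties.Ring ring using (-0#≈0#; -‿+-comm)
  open import Algebra.Properties.CommutativeSemigroup +-commutativeSemigroup using () renaming (interchange to +-interchange)
  open import Relation.Binary.Reasoning.Setoid setoid

  private variable n : ℕ

  sumFin-cong : ∀ n {f g : Fin n → Carrier} → (∀ i → f i ≈ g i) → sumFin R n f ≈ sumFin R n g
  sumFin-cong zero    f≈g = refl
  sumFin-cong (suc n) f≈g = +-cong (f≈g zero) (sumFin-cong n (f≈g ∘ suc))

  sumFin-≈0 : ∀ n {f : Fin n → Carrier} → (∀ i → f i ≈ 0#) → sumFin R n f ≈ 0#
  sumFin-≈0 zero    f≈0 = refl
  sumFin-≈0 (suc n) f≈0 = trans (+-cong (f≈0 zero) (sumFin-≈0 n (f≈0 ∘ suc))) (+-identityʳ 0#)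

  sumFin-+ : ∀ n (f g : Fin n → Carrier) → sumFin R n (λ i → f i + g i) ≈ sumFin R n f + sumFin R n g
  sumFin-+ zero    f g = sym (+-identityʳ 0#)
  sumFin-+ (suc n) f g = trans (+-congˡ (sumFin-+ n (f ∘ suc) (g ∘ suc))) (+-interchange _ _ _ _)

  sumFin-neg : ∀ n (f : Fin n → Carrier) → sumFin R n (λ i → - f i) ≈ - sumFin R n f
  sumFin-neg zero    f = sym -0#≈0#
  sumFin-neg (suc n) f = trans (+-congˡ (sumFin-neg n (f ∘ suc))) (-‿+-comm _ _)

  *-distribˡ-sumFin : ∀ n a (f : Fin n → Carrier) → a * sumFin R n f ≈ sumFin R n (λ i → a * f i)
  *-distribˡ-sumFin zero    a f = zeroʳ a
  *-distribˡ-sumFin (suc n) a f = trans (distribˡ a _ _) (+-congˡ (*-distribˡ-sumFin n a (f ∘ suc)))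

  sumFin-linear : ∀ n a b (f g : Fin n → Carrier) →
                  sumFin R n (λ i → a * f i + b * g i) ≈ a * sumFin R n f + b * sumFin R n g
  sumFin-linear n a b f g = begin
    sumFin R n (λ i → a * f i + b * g i)                   ≈⟨ sumFin-+ n _ _ ⟩
    sumFin R n (λ i → a * f i) + sumFin R n (λ i → b * g i) ≈⟨ +-cong (*-distribˡ-sumFin n a f) (*-distribˡ-sumFin n b g) ⟨
    a * sumFin R n f + b * sumFin R n g                    ∎

  sumFin-single : ∀ n (f : Fin n → Carrier) c → (∀ k → k ≢ c → f k ≈ 0#) → sumFin R n f ≈ f c
  sumFin-single (suc n) f zero    f≈0 =
    trans (+-congˡ (sumFin-≈0 n (λ k → f≈0 (suc k) λ ()))) (+-identityʳ _)
  sumFin-single (suc n) f (suc c) f≈0 =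
    trans (+-congʳ (f≈0 zero λ ())) (trans (+-identityˡ _)
      (sumFin-single n (f ∘ suc) c (λ k k≢c → f≈0 (suc k) (k≢c ∘ suc-injective))))

  _·_ : Vector Carrier n → Vector Carrier n → Carrier
  _·_ {n} U V = sumFin R n λ i → U i * V i

  ·-empty : n ≤ 0 → (U V : Vector Carrier n) → U · V ≈ 0#
  ·-empty z≤n U V = refl

  sumTo : ℕ → (ℕ → Carrier) → Carrier
  sumTo zero    g = 0#
  sumTo (suc n) g = sumTo n g + g n

  sumTo-suc : ∀ n g → sumTo (suc n) g ≈ g 0 + sumTo n (g ∘ suc)
  sumTo-suc zero    g = +-comm 0# (g 0)
  sumTo-suc (suc n) g = trans (+-congʳ (sumTo-suc n g)) (+-assoc (g 0) _ _)

  sumFin-toℕ : ∀ n g → sumFin R n (g ∘ toℕ) ≈ sumTo n g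
  sumFin-toℕ zero    g = refl
  sumFin-toℕ (suc n) g = trans (+-congˡ (sumFin-toℕ n (g ∘ suc))) (sym (sumTo-suc n g))

  *-distribˡ-sumTo : ∀ n a g → a * sumTo n g ≈ sumTo n (λ m → a * g m)
  *-distribˡ-sumTo zero    a g = zeroʳ a
  *-distribˡ-sumTo (suc n) a g = trans (distribˡ a _ _) (+-congʳ (*-distribˡ-sumTo n a g))

  sumTo-telescope₂ : ∀ (g G : ℕ → Carrier) → G 0 ≈ 0# → (∀ m → G (suc (suc m)) ≈ G m + g m + g (suc m)) →
                     ∀ k → sumTo (k ℕ.* 2) g ≈ G (k ℕ.* 2)
  sumTo-telescope₂ g G G₀≈0 step zero    = sym G₀≈0
  sumTo-telescope₂ g G G₀≈0 step (suc k) =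
    trans (+-congʳ (+-congʳ (sumTo-telescope₂ g G G₀≈0 step k))) (sym (step (k ℕ.* 2)))

module Determinants {c ℓ : Level} (R : CommutativeRing c ℓ) where
  open CommutativeRing R hiding (zero)
  open IntegerCoefficientSolver R using (solve; _:=_; _:+_; _:*_; :-_; _:-_; con)
  open FiniteSums R
  open import Algebra.Properties.Ring ring using (-‿involutive; -0#≈0#; -‿distribˡ-*)
  open import Algebra.Properties.Group +-group using (inverseʳ-unique)
  open import Relation.Binary.Reasoning.Setoid setoid

  private variable n : ℕ

  δ-diag : ∀ (i : Fin n) → δ R i i ≡ 1#
  δ-diag i with i ≟ᶠ i
  ... | yes _  = ≡.refl
  ... | no i≢i = ⊥-elim (i≢i ≡.refl)

  δ-≢ : ∀ {i j : Fin n} → i ≢ j → δ R i j ≡ 0#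
  δ-≢ {i = i} {j} i≢j with i ≟ᶠ j
  ... | yes i≡j = ⊥-elim (i≢j i≡j)
  ... | no _    = ≡.refl

  δ-punchIn : ∀ (r : Fin (suc n)) i j → δ R (punchIn r i) (punchIn r j) ≡ δ R i j
  δ-punchIn r i j with i ≟ᶠ j
  ... | yes ≡.refl = δ-diag (punchIn r i)
  ... | no i≢j     = δ-≢ (i≢j ∘ punchIn-injective r i j)

  Matrix : ℕ → Set c
  Matrix n = Vector (Vector Carrier n) n

  minor : Matrix (suc n) → Fin (suc n) → Fin (suc n) → Matrix n
  minor M r c i j = M (punchIn r i) (punchIn c j)

  setRow : Matrix n → Fin n → Vector Carrier n → Matrix n
  setRow M r y = updateAt M r (const y)

  updateAt-const-map : ∀ {a b} {A : Set a} {B : Set b} {m} (r : Fin m) (xs : Vector A m) y (g : A → B) i →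
                       g (updateAt xs r (const y) i) ≡ updateAt (g ∘ xs) r (const (g y)) i
  updateAt-const-map zero    xs y g zero    = ≡.refl
  updateAt-const-map zero    xs y g (suc i) = ≡.refl
  updateAt-const-map (suc r) xs y g zero    = ≡.refl
  updateAt-const-map (suc r) xs y g (suc i) = updateAt-const-map r (xs ∘ suc) y g i

  minor-setRow : ∀ (r : Fin n) k (M : Matrix (suc n)) y i j →
                 minor (setRow M (suc r) y) zero k i j ≡ setRow (minor M zero k) r (y ∘ punchIn k) i j
  minor-setRow r k M y i j = ≡.cong (λ row → row j) (updateAt-const-map r (M ∘ suc) y (_∘ punchIn k) i)

  laplaceTerm : Matrix (suc n) → Fin (suc n) → Carrier
  laplaceTerm {n} M k = sign R (toℕ k) * (M zero k * det R n (minor M zero k))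

  det-cong : ∀ n {M N : Matrix n} → (∀ i j → M i j ≈ N i j) → det R n M ≈ det R n N
  det-cong zero    M≈N = refl
  det-cong (suc n) {M} {N} M≈N = sumFin-cong (suc n) {laplaceTerm M} {laplaceTerm N} λ k →
    *-congˡ (*-cong (M≈N zero k) (det-cong n λ i j → M≈N (suc i) (punchIn k j)))

  laplaceTerm-row-linear : ∀ n (r : Fin (suc n)) (M : Matrix (suc n)) a b y z → (∀ j → M r j ≈ a * y j + b * z j) →
                           ∀ k → laplaceTerm M k ≈ a * laplaceTerm (setRow M r y) k + b * laplaceTerm (setRow M r z) k
  det-row-linear : ∀ n (r : Fin n) (M : Matrix n) a b y z → (∀ j → M r j ≈ a * y j + b * z j) →
                   det R n M ≈ a * det R n (setRow M r y) + b * det R n (setRow M r z)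

  laplaceTerm-row-linear n zero M a b y z row≈ k =
    trans (*-congˡ (*-congʳ (row≈ k))) (expand (sign R (toℕ k)) a b (y k) (z k) (det R n (minor M zero k)))
    where
    expand : ∀ s a b y z D → s * ((a * y + b * z) * D) ≈ a * (s * (y * D)) + b * (s * (z * D))
    expand = solve 6 (λ s a b y z D → s :* ((a :* y :+ b :* z) :* D) := a :* (s :* (y :* D)) :+ b :* (s :* (z :* D))) refl
  laplaceTerm-row-linear n (suc r) M a b y z row≈ k =
    trans (*-congˡ (*-congˡ minor-linear)) (expand (sign R (toℕ k)) (M zero k) a b _ _)
    where
    expand : ∀ s m a b Y Z → s * (m * (a * Y + b * Z)) ≈ a * (s * (m * Y)) + b * (s * (m * Z))
    expand = solve 6 (λ s m a b Y Z → s :* (m :* (a :* Y :+ b :* Z)) := a :* (s :* (m :* Y)) :+ b :* (s :* (m :* Z))) refl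
    minor-linear : det R n (minor M zero k) ≈
                   a * det R n (minor (setRow M (suc r) y) zero k) + b * det R n (minor (setRow M (suc r) z) zero k)
    minor-linear = trans (det-row-linear n r (minor M zero k) a b (y ∘ punchIn k) (z ∘ punchIn k) (row≈ ∘ punchIn k))
      (+-cong (*-congˡ (det-cong n λ i j → reflexive (≡.sym (minor-setRow r k M y i j))))
              (*-congˡ (det-cong n λ i j → reflexive (≡.sym (minor-setRow r k M z i j)))))

  det-row-linear (suc n) r M a b y z row≈ =
    trans (sumFin-cong (suc n) {laplaceTerm M} {λ k → a * laplaceTerm My k + b * laplaceTerm Mz k}
                       (laplaceTerm-row-linear n r M a b y z row≈))
          (sumFin-linear (suc n) a b (laplaceTerm My) (laplaceTerm Mz))
    where
    My Mz : Matrix (suc n)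
    My = setRow M r y
    Mz = setRow M r z

  det-setRow-setRow : ∀ n (M : Matrix n) r y z → det R n (setRow (setRow M r y) r z) ≈ det R n (setRow M r z)
  det-setRow-setRow n M r y z = det-cong n λ i j → reflexive (≡.cong (λ row → row j) (updateAt-updateAt r M i))

  det-row-linear₃ : ∀ n (r : Fin n) (M : Matrix n) a b d y z w → (∀ j → M r j ≈ a * y j + b * z j + d * w j) →
                    det R n M ≈ a * det R n (setRow M r y) + b * det R n (setRow M r z) + d * det R n (setRow M r w)
  det-row-linear₃ n r M a b d y z w row≈ = begin
    det R n M
      ≈⟨ det-row-linear n r M 1# d yz w (λ j → trans (row≈ j) (+-congʳ (sym (*-identityˡ _)))) ⟩
    1# * det R n (setRow M r yz) + d * det R n (setRow M r w)
      ≈⟨ +-congʳ (trans (*-identityˡ _) (det-row-linear n r (setRow M r yz) a b y z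
                                           (λ j → reflexive (≡.cong (λ row → row j) (updateAt-updates r M))))) ⟩
    a * det R n (setRow (setRow M r yz) r y) + b * det R n (setRow (setRow M r yz) r z) + d * det R n (setRow M r w)
      ≈⟨ +-congʳ (+-cong (*-congˡ (det-setRow-setRow n M r yz y)) (*-congˡ (det-setRow-setRow n M r yz z))) ⟩
    a * det R n (setRow M r y) + b * det R n (setRow M r z) + d * det R n (setRow M r w) ∎
    where
    yz : Vector Carrier n
    yz j = a * y j + b * z j

  det-firstRow-unit : ∀ n (M : Matrix (suc n)) c → (∀ j → M zero j ≈ δ R c j) →
                      det R (suc n) M ≈ sign R (toℕ c) * det R n (minor M zero c)
  det-firstRow-unit n M c row≈δ = begin
    det R (suc n) M
      ≈⟨ sumFin-single (suc n) (laplaceTerm M) c off-c ⟩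
    sign R (toℕ c) * (M zero c * det R n (minor M zero c))
      ≈⟨ *-congˡ (trans (*-congʳ (trans (row≈δ c) (reflexive (δ-diag c)))) (*-identityˡ _)) ⟩
    sign R (toℕ c) * det R n (minor M zero c) ∎
    where
    off-c : ∀ k → k ≢ c → laplaceTerm M k ≈ 0#
    off-c k k≢c = begin
      sign R (toℕ k) * (M zero k * det R n (minor M zero k))
        ≈⟨ *-congˡ (*-congʳ (trans (row≈δ k) (reflexive (δ-≢ (k≢c ∘ ≡.sym))))) ⟩
      sign R (toℕ k) * (0# * det R n (minor M zero k))       ≈⟨ *-congˡ (zeroˡ _) ⟩
      sign R (toℕ k) * 0#                                    ≈⟨ zeroʳ _ ⟩
      0#                                                     ∎

  -- Two steps of the Laplace expansion of a determinant whose two top rows both equal a;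
  -- F g is the determinant of the remaining rows restricted to the columns g.
  doubleLaplaceTerm : ∀ N → Vector Carrier (suc (suc N)) → ((Fin N → Fin (suc (suc N))) → Carrier) → Fin (suc (suc N)) → Carrier
  doubleLaplaceTerm N a F k = sign R (toℕ k) * (a k *
    sumFin R (suc N) λ j → sign R (toℕ j) * (a (punchIn k j) * F (punchIn k ∘ punchIn j)))

  doubleLaplace : ∀ N → Vector Carrier (suc (suc N)) → ((Fin N → Fin (suc (suc N))) → Carrier) → Carrier
  doubleLaplace N a F = sumFin R (suc (suc N)) (doubleLaplaceTerm N a F)

  -- The terms of doubleLaplace in which neither top row uses column 0; the others cancel in pairs.
  offColumn₀ : ∀ N → Vector Carrier (suc (suc N)) → ((Fin N → Fin (suc (suc N))) → Carrier) → Fin (suc N) → Carrier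
  offColumn₀ N a F k = sign R (toℕ (suc k)) * (a (suc k) *
    sumFin R N λ j → sign R (toℕ (suc j)) * (a (punchIn (suc k) (suc j)) * F (punchIn (suc k) ∘ punchIn (suc j))))

  doubleLaplace-cancel₀ : ∀ N a F → doubleLaplace N a F ≈ sumFin R (suc N) (offColumn₀ N a F)
  doubleLaplace-cancel₀ N a F = begin
    term zero + sumFin R (suc N) (term ∘ suc)
      ≈⟨ +-congˡ (trans (sumFin-cong (suc N) {term ∘ suc} {λ k → onColumn₀ k + offColumn₀ N a F k} split)
                        (sumFin-+ (suc N) onColumn₀ (offColumn₀ N a F))) ⟩
    term zero + (sumFin R (suc N) onColumn₀ + sumFin R (suc N) (offColumn₀ N a F))
      ≈⟨ +-assoc _ _ _ ⟨
    (term zero + sumFin R (suc N) onColumn₀) + sumFin R (suc N) (offColumn₀ N a F)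
      ≈⟨ +-congʳ pairs-cancel ⟩
    0# + sumFin R (suc N) (offColumn₀ N a F)
      ≈⟨ +-identityˡ _ ⟩
    sumFin R (suc N) (offColumn₀ N a F) ∎
    where
    term : Fin (suc (suc N)) → Carrier
    term = doubleLaplaceTerm N a F
    onColumn₀ : Fin (suc N) → Carrier
    onColumn₀ k = sign R (toℕ (suc k)) * (a (suc k) * (1# * (a zero * F (suc ∘ punchIn k))))
    split : ∀ k → term (suc k) ≈ onColumn₀ k + offColumn₀ N a F k
    split k = expand (sign R (toℕ (suc k))) (a (suc k)) _ _
      where
      expand : ∀ s b X J → s * (b * (X + J)) ≈ s * (b * X) + s * (b * J)
      expand = solve 4 (λ s b X J → s :* (b :* (X :+ J)) := s :* (b :* X) :+ s :* (b :* J)) refl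
    minorTerm₀ : Fin (suc N) → Carrier
    minorTerm₀ j = sign R (toℕ j) * (a (suc j) * F (suc ∘ punchIn j))
    pair : ∀ j → 1# * (a zero * minorTerm₀ j) + onColumn₀ j ≈ 0#
    pair j = cancel (sign R (toℕ j)) (a zero) (a (suc j)) (F (suc ∘ punchIn j))
      where
      cancel : ∀ s a₀ b G → 1# * (a₀ * (s * (b * G))) + (- s) * (b * (1# * (a₀ * G))) ≈ 0#
      cancel = solve 4 (λ s a₀ b G → con (+ 1) :* (a₀ :* (s :* (b :* G))) :+ (:- s) :* (b :* (con (+ 1) :* (a₀ :* G)))
                                     := con (+ 0)) refl
    pairs-cancel : term zero + sumFin R (suc N) onColumn₀ ≈ 0#
    pairs-cancel = begin
      term zero + sumFin R (suc N) onColumn₀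
        ≈⟨ +-congʳ (trans (*-congˡ (*-distribˡ-sumFin (suc N) (a zero) minorTerm₀))
                          (*-distribˡ-sumFin (suc N) 1# (λ j → a zero * minorTerm₀ j))) ⟩
      sumFin R (suc N) (λ j → 1# * (a zero * minorTerm₀ j)) + sumFin R (suc N) onColumn₀
        ≈⟨ sumFin-+ (suc N) (λ j → 1# * (a zero * minorTerm₀ j)) onColumn₀ ⟨
      sumFin R (suc N) (λ j → 1# * (a zero * minorTerm₀ j) + onColumn₀ j)
        ≈⟨ sumFin-≈0 (suc N) pair ⟩
      0# ∎

  doubleLaplace-shift : ∀ N a F → (∀ {g h} → g ≗ h → F g ≈ F h) →
                        sumFin R (suc (suc N)) (offColumn₀ (suc N) a F) ≈ doubleLaplace N (a ∘ suc) (F ∘ lift 1)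
  doubleLaplace-shift N a F F-cong =
    sumFin-cong (suc (suc N)) {offColumn₀ (suc N) a F} {doubleLaplaceTerm N (a ∘ suc) (F ∘ lift 1)} λ k →
      trans (*-congˡ (*-congˡ (trans (sumFin-cong (suc N) {original k} {λ j → - shifted k j} (negated k))
                                     (sumFin-neg (suc N) (shifted k)))))
            (double-negation (sign R (toℕ k)) (a (suc k)) (sumFin R (suc N) (shifted k)))
    where
    original shifted : Fin (suc (suc N)) → Fin (suc N) → Carrier
    original k j = sign R (toℕ (suc j)) * (a (punchIn (suc k) (suc j)) * F (punchIn (suc k) ∘ punchIn (suc j)))
    shifted  k j = sign R (toℕ j) * (a (suc (punchIn k j)) * F (lift 1 (punchIn k ∘ punchIn j)))
    lifted : ∀ k j → punchIn (suc k) ∘ punchIn (suc j) ≗ lift 1 (punchIn k ∘ punchIn j)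
    lifted k j zero    = ≡.refl
    lifted k j (suc m) = ≡.refl
    negated : ∀ k j → original k j ≈ - shifted k j
    negated k j = trans (*-congˡ (*-congˡ (F-cong (lifted k j)))) (pull (sign R (toℕ j)) (a (suc (punchIn k j))) _)
      where
      pull : ∀ s b Y → (- s) * (b * Y) ≈ - (s * (b * Y))
      pull = solve 3 (λ s b Y → (:- s) :* (b :* Y) := :- (s :* (b :* Y))) refl
    double-negation : ∀ s b I → (- s) * (b * (- I)) ≈ s * (b * I)
    double-negation = solve 3 (λ s b I → (:- s) :* (b :* (:- I)) := s :* (b :* I)) refl

  doubleLaplace≈0 : ∀ N a F → (∀ {g h} → g ≗ h → F g ≈ F h) → doubleLaplace N a F ≈ 0#
  doubleLaplace≈0 zero    a F F-cong =
    trans (doubleLaplace-cancel₀ zero a F) (sumFin-≈0 1 {offColumn₀ zero a F} λ k → trans (*-congˡ (zeroʳ _)) (zeroʳ _))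
  doubleLaplace≈0 (suc N) a F F-cong = begin
    doubleLaplace (suc N) a F                              ≈⟨ doubleLaplace-cancel₀ (suc N) a F ⟩
    sumFin R (suc (suc N)) (offColumn₀ (suc N) a F)       ≈⟨ doubleLaplace-shift N a F F-cong ⟩
    doubleLaplace N (a ∘ suc) (F ∘ lift 1)                ≈⟨ doubleLaplace≈0 N (a ∘ suc) (F ∘ lift 1) (F-cong ∘ lift-cong) ⟩
    0#                                                    ∎
    where
    lift-cong : ∀ {g h : Fin N → Fin (suc (suc N))} → g ≗ h → lift 1 g ≗ lift 1 h
    lift-cong g≗h zero    = ≡.refl
    lift-cong g≗h (suc m) = ≡.cong suc (g≗h m)

  det-equalAdjacentRows : ∀ n (r : Fin n) (M : Matrix (suc n)) → (∀ j → M (inject₁ r) j ≈ M (suc r) j) →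
                          det R (suc n) M ≈ 0#
  det-equalAdjacentRows (suc n) zero M rows≈ =
    trans (sumFin-cong (suc (suc n)) {laplaceTerm M} {λ k → sign R (toℕ k) * (M zero k * inner k)} λ k →
             *-congˡ (*-congˡ (sumFin-cong (suc n) {laplaceTerm (minor M zero k)} λ j →
               *-congˡ (*-congʳ (sym (rows≈ (punchIn k j)))))))
          (doubleLaplace≈0 n (M zero) F F-cong)
    where
    F : (Fin n → Fin (suc (suc n))) → Carrier
    F g = det R n λ i m → M (suc (suc i)) (g m)
    F-cong : ∀ {g h} → g ≗ h → F g ≈ F h
    F-cong g≗h = det-cong n λ i m → reflexive (≡.cong (M (suc (suc i))) (g≗h m))
    inner : Fin (suc (suc n)) → Carrier
    inner k = sumFin R (suc n) λ j → sign R (toℕ j) * (M zero (punchIn k j) * F (punchIn k ∘ punchIn j))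
  det-equalAdjacentRows (suc n) (suc r) M rows≈ =
    sumFin-≈0 (suc (suc n)) {laplaceTerm M} λ k →
      trans (*-congˡ (*-congˡ (det-equalAdjacentRows n r (minor M zero k) (rows≈ ∘ punchIn k))))
            (trans (*-congˡ (zeroʳ _)) (zeroʳ _))

  swapAdjacent : ∀ {a} {A : Set a} {n} → Fin n → Vector A (suc n) → Vector A (suc n)
  swapAdjacent zero    xs zero          = xs (suc zero)
  swapAdjacent zero    xs (suc zero)    = xs zero
  swapAdjacent zero    xs (suc (suc i)) = xs (suc (suc i))
  swapAdjacent (suc r) xs zero          = xs zero
  swapAdjacent (suc r) xs (suc i)       = swapAdjacent r (xs ∘ suc) i

  swapAdjacent-map : ∀ {a b} {A : Set a} {B : Set b} {n} (r : Fin n) (xs : Vector A (suc n)) (g : A → B) i →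
                     g (swapAdjacent r xs i) ≡ swapAdjacent r (g ∘ xs) i
  swapAdjacent-map zero    xs g zero          = ≡.refl
  swapAdjacent-map zero    xs g (suc zero)    = ≡.refl
  swapAdjacent-map zero    xs g (suc (suc i)) = ≡.refl
  swapAdjacent-map (suc r) xs g zero          = ≡.refl
  swapAdjacent-map (suc r) xs g (suc i)       = swapAdjacent-map r (xs ∘ suc) g i

  swapAdjacent-inject₁ : ∀ {a} {A : Set a} {n} (r : Fin n) (xs : Vector A (suc n)) → swapAdjacent r xs (inject₁ r) ≡ xs (suc r)
  swapAdjacent-inject₁ zero    xs = ≡.refl
  swapAdjacent-inject₁ (suc r) xs = swapAdjacent-inject₁ r (xs ∘ suc)

  swapAdjacent-punchIn : ∀ {a} {A : Set a} {n} (r : Fin n) (xs : Vector A (suc n)) i →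
                         swapAdjacent r xs (punchIn (inject₁ r) i) ≡ xs (punchIn (suc r) i)
  swapAdjacent-punchIn zero    xs zero    = ≡.refl
  swapAdjacent-punchIn zero    xs (suc i) = ≡.refl
  swapAdjacent-punchIn (suc r) xs zero    = ≡.refl
  swapAdjacent-punchIn (suc r) xs (suc i) = swapAdjacent-punchIn r (xs ∘ suc) i

  det-swapAdjacent : ∀ n (r : Fin n) (M : Matrix (suc n)) → det R (suc n) (swapAdjacent r M) ≈ - det R (suc n) M
  -- Expand 0 = det (B (a + b) (a + b)) bilinearly in the two top rows.
  det-swapAdjacent (suc n) zero M = inverseʳ-unique (D M) (D (swapAdjacent zero M)) (begin
    D M + D (swapAdjacent zero M)                     ≈⟨ +-cong (+-identityˡ _) (+-identityʳ _) ⟨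
    (0# + D M) + (D (swapAdjacent zero M) + 0#)       ≈⟨ +-cong (+-cong (equal a) B-M) (+-cong B-swap (equal b)) ⟨
    (D (B a a) + D (B a b)) + (D (B b a) + D (B b b)) ≈⟨ +-cong (split₁ a) (split₁ b) ⟨
    D (B a p) + D (B b p)                             ≈⟨ split₀ p ⟨
    D (B p p)                                         ≈⟨ equal p ⟩
    0#                                                ∎)
    where
    D : Matrix (suc (suc n)) → Carrier
    D = det R (suc (suc n))
    B : Vector Carrier (suc (suc n)) → Vector Carrier (suc (suc n)) → Matrix (suc (suc n))
    B y z zero          = y
    B y z (suc zero)    = z
    B y z (suc (suc i)) = M (suc (suc i))
    a b p : Vector Carrier (suc (suc n))
    a = M zero
    b = M (suc zero)
    p j = a j + b j
    B-M : D (B a b) ≈ D M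
    B-M = det-cong (suc (suc n)) {B a b} {M} λ { zero j → refl ; (suc zero) j → refl ; (suc (suc i)) j → refl }
    B-swap : D (B b a) ≈ D (swapAdjacent zero M)
    B-swap = det-cong (suc (suc n)) {B b a} {swapAdjacent zero M}
               λ { zero j → refl ; (suc zero) j → refl ; (suc (suc i)) j → refl }
    setRow₀ : ∀ y z w → D (setRow (B y z) zero w) ≈ D (B w z)
    setRow₀ y z w = det-cong (suc (suc n)) {setRow (B y z) zero w} {B w z}
                      λ { zero j → refl ; (suc zero) j → refl ; (suc (suc i)) j → refl }
    setRow₁ : ∀ y z w → D (setRow (B y z) (suc zero) w) ≈ D (B y w)
    setRow₁ y z w = det-cong (suc (suc n)) {setRow (B y z) (suc zero) w} {B y w}
                      λ { zero j → refl ; (suc zero) j → refl ; (suc (suc i)) j → refl }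
    equal : ∀ y → D (B y y) ≈ 0#
    equal y = det-equalAdjacentRows (suc n) zero (B y y) (λ j → refl)
    p≈a+b : ∀ j → p j ≈ 1# * a j + 1# * b j
    p≈a+b j = sym (+-cong (*-identityˡ _) (*-identityˡ _))
    split₀ : ∀ z → D (B p z) ≈ D (B a z) + D (B b z)
    split₀ z = trans (det-row-linear _ zero (B p z) 1# 1# a b p≈a+b)
                     (+-cong (trans (*-identityˡ _) (setRow₀ p z a)) (trans (*-identityˡ _) (setRow₀ p z b)))
    split₁ : ∀ y → D (B y p) ≈ D (B y a) + D (B y b)
    split₁ y = trans (det-row-linear _ (suc zero) (B y p) 1# 1# a b p≈a+b)
                     (+-cong (trans (*-identityˡ _) (setRow₁ y p a)) (trans (*-identityˡ _) (setRow₁ y p b)))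
  det-swapAdjacent (suc n) (suc r) M =
    trans (sumFin-cong (suc (suc n)) {laplaceTerm (swapAdjacent (suc r) M)} {λ k → - laplaceTerm M k} λ k →
             trans (*-congˡ (*-congˡ (trans (det-cong (suc n) (minor-swapAdjacent k)) (det-swapAdjacent n r (minor M zero k)))))
                   (negate (sign R (toℕ k)) (M zero k) _))
          (sumFin-neg (suc (suc n)) (laplaceTerm M))
    where
    minor-swapAdjacent : ∀ k i j → minor (swapAdjacent (suc r) M) zero k i j ≈ swapAdjacent r (minor M zero k) i j
    minor-swapAdjacent k i j = reflexive (≡.cong (λ row → row j) (swapAdjacent-map r (M ∘ suc) (_∘ punchIn k) i))
    negate : ∀ s m D → s * (m * (- D)) ≈ - (s * (m * D))
    negate = solve 3 (λ s m D → s :* (m :* (:- D)) := :- (s :* (m :* D))) refl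

  det-unitRow : ∀ n (r c : Fin (suc n)) (M : Matrix (suc n)) → (∀ j → M r j ≈ δ R c j) →
                det R (suc n) M ≈ sign R (toℕ r ℕ.+ toℕ c) * det R n (minor M r c)
  det-unitRow n = <-weakInduction UnitRow (λ c M → det-firstRow-unit n M c) step
    where
    UnitRow : Fin (suc n) → Set (c ⊔ ℓ)
    UnitRow r = ∀ c (M : Matrix (suc n)) → (∀ j → M r j ≈ δ R c j) →
                det R (suc n) M ≈ sign R (toℕ r ℕ.+ toℕ c) * det R n (minor M r c)
    step : ∀ r → UnitRow (inject₁ r) → UnitRow (suc r)
    step r unitRow c M row≈δ = begin
      det R (suc n) M                                           ≈⟨ -‿involutive _ ⟨
      - - det R (suc n) M                                       ≈⟨ -‿cong (det-swapAdjacent n r M) ⟨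
      - det R (suc n) (swapAdjacent r M)
        ≈⟨ -‿cong (unitRow c (swapAdjacent r M) λ j →
                     trans (reflexive (≡.cong (λ row → row j) (swapAdjacent-inject₁ r M))) (row≈δ j)) ⟩
      - (sign R (toℕ (inject₁ r) ℕ.+ toℕ c) * det R n (minor (swapAdjacent r M) (inject₁ r) c))
        ≈⟨ -‿cong (*-cong (reflexive (≡.cong (λ k → sign R (k ℕ.+ toℕ c)) (toℕ-inject₁ r)))
                          (det-cong n λ i j → reflexive (≡.cong (λ row → row (punchIn c j)) (swapAdjacent-punchIn r M i)))) ⟩
      - (sign R (toℕ r ℕ.+ toℕ c) * det R n (minor M (suc r) c)) ≈⟨ -‿distribˡ-* _ _ ⟩
      sign R (toℕ (suc r) ℕ.+ toℕ c) * det R n (minor M (suc r) c) ∎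

  sign-double : ∀ m → sign R (m ℕ.+ m) ≈ 1#
  sign-double zero    = refl
  sign-double (suc m) = begin
    sign R (suc m ℕ.+ suc m)   ≡⟨ ≡.cong (λ k → - sign R k) (+-suc m m) ⟩
    - - sign R (m ℕ.+ m)       ≈⟨ -‿involutive _ ⟩
    sign R (m ℕ.+ m)           ≈⟨ sign-double m ⟩
    1#                         ∎

  det-principalUnitRow : ∀ n (r : Fin (suc n)) (M : Matrix (suc n)) → (∀ j → M r j ≈ δ R r j) →
                         det R (suc n) M ≈ det R n (minor M r r)
  det-principalUnitRow n r M row≈δ =
    trans (det-unitRow n r r M row≈δ) (trans (*-congʳ (sign-double (toℕ r))) (*-identityˡ _))

  det-2×2 : ∀ (M : Matrix 2) → det R 2 M ≈ M zero zero * M (suc zero) (suc zero) - M zero (suc zero) * M (suc zero) zero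
  det-2×2 M = expand _ _ _ _
    where
    expand : ∀ a b c d → 1# * (a * (1# * (d * 1#) + 0#)) + ((- 1#) * (b * (1# * (c * 1#) + 0#)) + 0#) ≈ a * d - b * c
    expand = solve 4 (λ a b c d → con (+ 1) :* (a :* (con (+ 1) :* (d :* con (+ 1)) :+ con (+ 0)))
                                  :+ ((:- con (+ 1)) :* (b :* (con (+ 1) :* (c :* con (+ 1)) :+ con (+ 0))) :+ con (+ 0))
                                  := a :* d :- b :* c) refl

  det-equalRows₀₂ : ∀ n (M : Matrix (suc (suc (suc n)))) → (∀ j → M zero j ≈ M (suc (suc zero)) j) →
                    det R (suc (suc (suc n))) M ≈ 0#
  det-equalRows₀₂ n M rows≈ = begin
    det R _ M                                        ≈⟨ -‿involutive _ ⟨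
    - - det R _ M                                    ≈⟨ -‿cong (det-swapAdjacent _ (suc zero) M) ⟨
    - det R _ (swapAdjacent (suc zero) M)            ≈⟨ -‿cong (det-equalAdjacentRows _ zero (swapAdjacent (suc zero) M) rows≈) ⟩
    - 0#                                             ≈⟨ -0#≈0# ⟩
    0#                                               ∎

module RankTwoPerturbation {c ℓ : Level} (R : CommutativeRing c ℓ) (x : CommutativeRing.Carrier R) where
  open CommutativeRing R hiding (zero)
  open IntegerCoefficientSolver R using (solve; _:=_; _:+_; _:*_; :-_; _:-_; con)
  open FiniteSums R
  open Determinants R
  open import Algebra.Properties.CommutativeSemigroup *-commutativeSemigroup using (x∙yz≈y∙xz)
  open import Relation.Binary.Reasoning.Setoid setoid

  private variable n : ℕ

  -- The hypothesis compensates for the truncated subtraction when n ≤ k.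
  *-pow-∸ : ∀ k n a → (n ≤ k → a ≈ 0#) → x * (a * pow R x (n ∸ suc k)) ≈ a * pow R x (n ∸ k)
  *-pow-∸ k       zero    a a≈0 = trans (*-congˡ a*X≈0) (trans (zeroʳ x) (sym a*X≈0))
    where
    a*X≈0 : ∀ {X} → a * X ≈ 0#
    a*X≈0 = trans (*-congʳ (a≈0 z≤n)) (zeroˡ _)
  *-pow-∸ zero    (suc n) a a≈0 = x∙yz≈y∙xz x a (pow R x n)
  *-pow-∸ (suc k) (suc n) a a≈0 = *-pow-∸ k n a (a≈0 ∘ s≤s)

  x*d-[p*y+q*z] : ∀ x d p y q z → x * d - (p * y + q * z) ≈ x * d + (- p) * y + (- q) * z
  x*d-[p*y+q*z] = solve 6 (λ x d p y q z → x :* d :- (p :* y :+ q :* z) := x :* d :+ (:- p) :* y :+ (:- q) :* z) refl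

  twoRowBordered : Vector Carrier (suc (suc n)) → Vector Carrier (suc (suc n)) → Vector Carrier n → Vector Carrier n →
                   Matrix (suc (suc n))
  twoRowBordered Y Z P Q zero          = Y
  twoRowBordered Y Z P Q (suc zero)    = Z
  twoRowBordered Y Z P Q (suc (suc i)) = λ j → x * δ R (suc (suc i)) j - (P i * Y j + Q i * Z j)

  det-twoRowBordered : ∀ n Y Z (P Q : Vector Carrier n) →
    det R (suc (suc n)) (twoRowBordered Y Z P Q) ≈ pow R x n * (Y zero * Z (suc zero) - Y (suc zero) * Z zero)
  det-twoRowBordered zero    Y Z P Q = trans (det-2×2 (twoRowBordered Y Z P Q)) (sym (*-identityˡ _))
  det-twoRowBordered (suc n) Y Z P Q = begin
    D M
      ≈⟨ det-row-linear₃ _ r₂ M x (- P zero) (- Q zero) (δ R r₂) Y Z (λ j → x*d-[p*y+q*z] x _ _ _ _ _) ⟩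
    x * D (setRow M r₂ (δ R r₂)) + (- P zero) * D (setRow M r₂ Y) + (- Q zero) * D (setRow M r₂ Z)
      ≈⟨ +-cong (+-cong (*-congˡ unitRow₂) (*-congˡ (det-equalRows₀₂ _ (setRow M r₂ Y) (λ j → refl))))
                (*-congˡ (det-equalAdjacentRows _ (suc zero) (setRow M r₂ Z) (λ j → refl))) ⟩
    x * (pow R x n * Δ) + (- P zero) * 0# + (- Q zero) * 0#
      ≈⟨ collect x (pow R x n) Δ (P zero) (Q zero) ⟩
    pow R x (suc n) * Δ ∎
    where
    D : Matrix (suc (suc (suc n))) → Carrier
    D = det R (suc (suc (suc n)))
    r₂ : Fin (suc (suc (suc n)))
    r₂ = suc (suc zero)
    M : Matrix (suc (suc (suc n)))
    M = twoRowBordered Y Z P Q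
    Δ : Carrier
    Δ = Y zero * Z (suc zero) - Y (suc zero) * Z zero
    minor≈ : ∀ i j → minor (setRow M r₂ (δ R r₂)) r₂ r₂ i j ≈ twoRowBordered (Y ∘ punchIn r₂) (Z ∘ punchIn r₂) (tail P) (tail Q) i j
    minor≈ zero          j = refl
    minor≈ (suc zero)    j = refl
    minor≈ (suc (suc i)) j = +-congʳ (*-congˡ (reflexive (δ-punchIn r₂ (suc (suc i)) j)))
    unitRow₂ : D (setRow M r₂ (δ R r₂)) ≈ pow R x n * Δ
    unitRow₂ = begin
      D (setRow M r₂ (δ R r₂))                      ≈⟨ det-principalUnitRow _ r₂ (setRow M r₂ (δ R r₂)) (λ j → refl) ⟩
      det R (suc (suc n)) (minor (setRow M r₂ (δ R r₂)) r₂ r₂) ≈⟨ det-cong (suc (suc n)) minor≈ ⟩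
      det R (suc (suc n)) (twoRowBordered (Y ∘ punchIn r₂) (Z ∘ punchIn r₂) (tail P) (tail Q))
        ≈⟨ det-twoRowBordered n (Y ∘ punchIn r₂) (Z ∘ punchIn r₂) (tail P) (tail Q) ⟩
      pow R x n * Δ                                 ∎
    collect : ∀ x X Δ p q → x * (X * Δ) + (- p) * 0# + (- q) * 0# ≈ (x * X) * Δ
    collect = solve 5 (λ x X Δ p q → x :* (X :* Δ) :+ (:- p) :* con (+ 0) :+ (:- q) :* con (+ 0) := (x :* X) :* Δ) refl

  rowBordered : Vector Carrier (suc n) → Vector Carrier n → Vector Carrier n → Vector Carrier (suc n) → Matrix (suc n)
  rowBordered Y P Q Z zero    = Y
  rowBordered Y P Q Z (suc i) = λ j → x * δ R (suc i) j - (P i * Y j + Q i * Z j)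

  det-rowBordered : ∀ n Y (P Q : Vector Carrier n) Z → det R (suc n) (rowBordered Y P Q Z) ≈
    Y zero * pow R x n - (Y zero * (Q · tail Z) - Z zero * (Q · tail Y)) * pow R x (n ∸ 1)
  det-rowBordered zero    Y P Q Z = expand (Y zero) (Z zero)
    where
    expand : ∀ y z → 1# * (y * 1#) + 0# ≈ y * 1# - (y * 0# - z * 0#) * 1#
    expand = solve 2 (λ y z → con (+ 1) :* (y :* con (+ 1)) :+ con (+ 0)
                              := y :* con (+ 1) :- (y :* con (+ 0) :- z :* con (+ 0)) :* con (+ 1)) refl
  det-rowBordered (suc n) Y P Q Z = begin
    D M
      ≈⟨ det-row-linear₃ _ r₁ M x (- P zero) (- Q zero) (δ R r₁) Y Z (λ j → x*d-[p*y+q*z] x _ _ _ _ _) ⟩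
    x * D (setRow M r₁ (δ R r₁)) + (- P zero) * D (setRow M r₁ Y) + (- Q zero) * D (setRow M r₁ Z)
      ≈⟨ +-cong (+-cong (*-congˡ unitRow₁) (*-congˡ (det-equalAdjacentRows _ zero (setRow M r₁ Y) (λ j → refl))))
                (*-congˡ (trans (det-cong _ {setRow M r₁ Z} {twoRowBordered Y Z (tail P) (tail Q)}
                                   λ { zero j → refl ; (suc zero) j → refl ; (suc (suc i)) j → refl })
                                (det-twoRowBordered n Y Z (tail P) (tail Q)))) ⟩
    x * (Y zero * X - κ * pow R x (n ∸ 1)) + (- P zero) * 0# + (- Q zero) * (X * Δ)
      ≈⟨ rearrange x (Y zero) X κ (pow R x (n ∸ 1)) (P zero) (Q zero) Δ ⟩
    Y zero * (x * X) - x * (κ * pow R x (n ∸ 1)) - Q zero * (X * Δ)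
      ≈⟨ +-congʳ (+-congˡ (-‿cong (*-pow-∸ 0 n κ κ≈0))) ⟩
    Y zero * (x * X) - κ * X - Q zero * (X * Δ)
      ≈⟨ collect (Y zero) (Y (suc zero)) (Z zero) (Z (suc zero)) (Q zero) (tail Q · tail (tail Z)) (tail Q · tail (tail Y)) x X ⟩
    Y zero * (x * X) - (Y zero * (Q · tail Z) - Z zero * (Q · tail Y)) * X ∎
    where
    D : Matrix (suc (suc n)) → Carrier
    D = det R (suc (suc n))
    r₁ : Fin (suc (suc n))
    r₁ = suc zero
    M : Matrix (suc (suc n))
    M = rowBordered Y P Q Z
    X Δ κ : Carrier
    X = pow R x n
    Δ = Y zero * Z (suc zero) - Y (suc zero) * Z zero
    κ = Y zero * (tail Q · tail (tail Z)) - Z zero * (tail Q · tail (tail Y))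
    κ≈0 : n ≤ 0 → κ ≈ 0#
    κ≈0 n≤0 = trans (+-cong (*-congˡ (·-empty n≤0 _ _)) (-‿cong (*-congˡ (·-empty n≤0 _ _)))) (y*0-z*0 (Y zero) (Z zero))
      where
      y*0-z*0 : ∀ y z → y * 0# - z * 0# ≈ 0#
      y*0-z*0 = solve 2 (λ y z → y :* con (+ 0) :- z :* con (+ 0) := con (+ 0)) refl
    minor≈ : ∀ i j → minor (setRow M r₁ (δ R r₁)) r₁ r₁ i j ≈ rowBordered (Y ∘ punchIn r₁) (tail P) (tail Q) (Z ∘ punchIn r₁) i j
    minor≈ zero    j = refl
    minor≈ (suc i) j = +-congʳ (*-congˡ (reflexive (δ-punchIn r₁ (suc i) j)))
    unitRow₁ : D (setRow M r₁ (δ R r₁)) ≈ Y zero * X - κ * pow R x (n ∸ 1)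
    unitRow₁ = begin
      D (setRow M r₁ (δ R r₁))                          ≈⟨ det-principalUnitRow _ r₁ (setRow M r₁ (δ R r₁)) (λ j → refl) ⟩
      det R (suc n) (minor (setRow M r₁ (δ R r₁)) r₁ r₁) ≈⟨ det-cong (suc n) minor≈ ⟩
      det R (suc n) (rowBordered (Y ∘ punchIn r₁) (tail P) (tail Q) (Z ∘ punchIn r₁))
        ≈⟨ det-rowBordered n (Y ∘ punchIn r₁) (tail P) (tail Q) (Z ∘ punchIn r₁) ⟩
      Y zero * X - κ * pow R x (n ∸ 1)                  ∎
    rearrange : ∀ x y X c X₁ p q Δ → x * (y * X - c * X₁) + (- p) * 0# + (- q) * (X * Δ) ≈ y * (x * X) - x * (c * X₁) - q * (X * Δ)
    rearrange = solve 8 (λ x y X c X₁ p q Δ → x :* (y :* X :- c :* X₁) :+ (:- p) :* con (+ 0) :+ (:- q) :* (X :* Δ)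
                                            := y :* (x :* X) :- x :* (c :* X₁) :- q :* (X :* Δ)) refl
    collect : ∀ y₀ y₁ z₀ z₁ q SZ SY x X →
      y₀ * (x * X) - (y₀ * SZ - z₀ * SY) * X - q * (X * (y₀ * z₁ - y₁ * z₀)) ≈
      y₀ * (x * X) - (y₀ * (q * z₁ + SZ) - z₀ * (q * y₁ + SY)) * X
    collect = solve 9 (λ y₀ y₁ z₀ z₁ q SZ SY x X →
      y₀ :* (x :* X) :- (y₀ :* SZ :- z₀ :* SY) :* X :- q :* (X :* (y₀ :* z₁ :- y₁ :* z₀)) :=
      y₀ :* (x :* X) :- (y₀ :* (q :* z₁ :+ SZ) :- z₀ :* (q :* y₁ :+ SY)) :* X) refl

  gram-vanishes : n ≤ 1 → (U V W Z : Vector Carrier n) → (U · V) * (W · Z) - (U · Z) * (W · V) ≈ 0#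
  gram-vanishes z≤n       U V W Z = 0*0-0*0
    where
    0*0-0*0 : 0# * 0# - 0# * 0# ≈ 0#
    0*0-0*0 = solve 0 (con (+ 0) :* con (+ 0) :- con (+ 0) :* con (+ 0) := con (+ 0)) refl
  gram-vanishes (s≤s z≤n) U V W Z = rank-one (U zero) (V zero) (W zero) (Z zero)
    where
    rank-one : ∀ u v w z → (u * v + 0#) * (w * z + 0#) - (u * z + 0#) * (w * v + 0#) ≈ 0#
    rank-one = solve 4 (λ u v w z → (u :* v :+ con (+ 0)) :* (w :* z :+ con (+ 0)) :- (u :* z :+ con (+ 0)) :* (w :* v :+ con (+ 0))
                                    := con (+ 0)) refl

  scalarMinusRankTwo : (U V W Z : Vector Carrier n) → Matrix n
  scalarMinusRankTwo U V W Z i j = x * δ R i j - (U i * V j + W i * Z j)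

  det-scalarMinusRankTwo : ∀ n (U V W Z : Vector Carrier n) → det R n (scalarMinusRankTwo U V W Z) ≈
    pow R x n - (U · V + W · Z) * pow R x (n ∸ 1) + ((U · V) * (W · Z) - (U · Z) * (W · V)) * pow R x (n ∸ 2)
  det-scalarMinusRankTwo zero    U V W Z = expand
    where
    expand : 1# ≈ 1# - (0# + 0#) * 1# + (0# * 0# - 0# * 0#) * 1#
    expand = solve 0 (con (+ 1) := con (+ 1) :- (con (+ 0) :+ con (+ 0)) :* con (+ 1)
                                   :+ (con (+ 0) :* con (+ 0) :- con (+ 0) :* con (+ 0)) :* con (+ 1)) refl
  det-scalarMinusRankTwo (suc n) U V W Z = begin
    det R (suc n) M
      ≈⟨ det-row-linear₃ _ zero M x (- U zero) (- W zero) (δ R zero) V Z (λ j → x*d-[p*y+q*z] x _ _ _ _ _) ⟩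
    x * D (setRow M zero (δ R zero)) + (- U zero) * D (setRow M zero V) + (- W zero) * D (setRow M zero Z)
      ≈⟨ +-cong (+-cong (*-congˡ unitRow₀) (*-congˡ row₀≈V)) (*-congˡ row₀≈Z) ⟩
    x * (X - (a + b) * X₁ + (a * b - c′ * d) * X₂)
      + (- U zero) * (V zero * X - (V zero * b - Z zero * d) * X₁)
      + (- W zero) * (Z zero * X - (Z zero * a - V zero * c′) * X₁)
      ≈⟨ +-congʳ (+-congʳ (distribute x X (a + b) X₁ (a * b - c′ * d) X₂)) ⟩
    (x * X - x * ((a + b) * X₁) + x * ((a * b - c′ * d) * X₂))
      + (- U zero) * (V zero * X - (V zero * b - Z zero * d) * X₁)
      + (- W zero) * (Z zero * X - (Z zero * a - V zero * c′) * X₁)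
      ≈⟨ +-congʳ (+-congʳ (+-cong (+-congˡ (-‿cong (*-pow-∸ 0 n (a + b) trace≈0)))
                                  (*-pow-∸ 1 n (a * b - c′ * d) (λ n≤1 → gram-vanishes n≤1 (tail U) (tail V) (tail W) (tail Z))))) ⟩
    (x * X - (a + b) * X + (a * b - c′ * d) * X₁)
      + (- U zero) * (V zero * X - (V zero * b - Z zero * d) * X₁)
      + (- W zero) * (Z zero * X - (Z zero * a - V zero * c′) * X₁)
      ≈⟨ collect x X X₁ (U zero) (V zero) (W zero) (Z zero) a b c′ d ⟩
    x * X - (U · V + W · Z) * X + ((U · V) * (W · Z) - (U · Z) * (W · V)) * X₁ ∎
    where
    D : Matrix (suc n) → Carrier
    D = det R (suc n)
    M : Matrix (suc n)
    M = scalarMinusRankTwo U V W Z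
    X X₁ X₂ a b c′ d : Carrier
    X  = pow R x n
    X₁ = pow R x (n ∸ 1)
    X₂ = pow R x (n ∸ 2)
    a  = tail U · tail V
    b  = tail W · tail Z
    c′ = tail U · tail Z
    d  = tail W · tail V
    trace≈0 : n ≤ 0 → a + b ≈ 0#
    trace≈0 n≤0 = trans (+-cong (·-empty n≤0 (tail U) (tail V)) (·-empty n≤0 (tail W) (tail Z))) (+-identityʳ 0#)
    unitRow₀ : D (setRow M zero (δ R zero)) ≈ X - (a + b) * X₁ + (a * b - c′ * d) * X₂
    unitRow₀ = begin
      D (setRow M zero (δ R zero))                 ≈⟨ det-principalUnitRow n zero (setRow M zero (δ R zero)) (λ j → refl) ⟩
      det R n (minor (setRow M zero (δ R zero)) zero zero)
        ≈⟨ det-cong n (λ i j → +-congʳ (*-congˡ (reflexive (δ-punchIn zero i j)))) ⟩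
      det R n (scalarMinusRankTwo (tail U) (tail V) (tail W) (tail Z))
        ≈⟨ det-scalarMinusRankTwo n (tail U) (tail V) (tail W) (tail Z) ⟩
      X - (a + b) * X₁ + (a * b - c′ * d) * X₂     ∎
    row₀≈V : D (setRow M zero V) ≈ V zero * X - (V zero * b - Z zero * d) * X₁
    row₀≈V = trans (det-cong (suc n) {setRow M zero V} {rowBordered V (tail U) (tail W) Z} λ { zero j → refl ; (suc i) j → refl })
                   (det-rowBordered n V (tail U) (tail W) Z)
    row₀≈Z : D (setRow M zero Z) ≈ Z zero * X - (Z zero * a - V zero * c′) * X₁
    row₀≈Z = trans (det-cong (suc n) {setRow M zero Z} {rowBordered Z (tail W) (tail U) V}
                      λ { zero j → refl ; (suc i) j → +-congˡ (-‿cong (+-comm _ _)) })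
                   (det-rowBordered n Z (tail W) (tail U) V)
    distribute : ∀ x X s X₁ g X₂ → x * (X - s * X₁ + g * X₂) ≈ x * X - x * (s * X₁) + x * (g * X₂)
    distribute = solve 6 (λ x X s X₁ g X₂ → x :* (X :- s :* X₁ :+ g :* X₂) := x :* X :- x :* (s :* X₁) :+ x :* (g :* X₂)) refl
    collect : ∀ x X X₁ u v w z a b c d →
      (x * X - (a + b) * X + (a * b - c * d) * X₁) + (- u) * (v * X - (v * b - z * d) * X₁) + (- w) * (z * X - (z * a - v * c) * X₁)
      ≈ x * X - ((u * v + a) + (w * z + b)) * X + ((u * v + a) * (w * z + b) - (u * z + c) * (w * v + d)) * X₁
    collect = solve 11 (λ x X X₁ u v w z a b c d →
      (x :* X :- (a :+ b) :* X :+ (a :* b :- c :* d) :* X₁) :+ (:- u) :* (v :* X :- (v :* b :- z :* d) :* X₁)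
        :+ (:- w) :* (z :* X :- (z :* a :- v :* c) :* X₁)
      := x :* X :- ((u :* v :+ a) :+ (w :* z :+ b)) :* X :+ ((u :* v :+ a) :* (w :* z :+ b) :- (u :* z :+ c) :* (w :* v :+ d)) :* X₁) refl

module LucasSequences {c ℓ : Level} (R : CommutativeRing c ℓ) where
  open CommutativeRing R hiding (zero)
  open IntegerCoefficientSolver R using (solve; _:=_; _:+_; _:*_; :-_; _:-_; con; :fromNat)
  open import Relation.Binary.Reasoning.Setoid setoid

  module _ (a b : Carrier) where
    private
      u v : ℕ → Carrier
      u = lucasU R a b
      v = lucasV R a b

    lucasV-+ : ∀ m k → v (m +ℕ k) ≈ u m * v (suc k) + (u (suc m) - a * u m) * v k
    lucasV-+ zero          k = base a (v (suc k)) (v k)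
      where
      base : ∀ a V₁ V₀ → V₀ ≈ 0# * V₁ + (1# - a * 0#) * V₀
      base = solve 3 (λ a V₁ V₀ → V₀ := con (+ 0) :* V₁ :+ (con (+ 1) :- a :* con (+ 0)) :* V₀) refl
    lucasV-+ (suc zero)    k = base a b (v (suc k)) (v k)
      where
      base : ∀ a b V₁ V₀ → V₁ ≈ 1# * V₁ + ((a * 1# - b * 0#) - a * 1#) * V₀
      base = solve 4 (λ a b V₁ V₀ → V₁ := con (+ 1) :* V₁ :+ ((a :* con (+ 1) :- b :* con (+ 0)) :- a :* con (+ 1)) :* V₀) refl
    lucasV-+ (suc (suc m)) k = begin
      a * v (suc m +ℕ k) - b * v (m +ℕ k)
        ≈⟨ +-cong (*-congˡ (lucasV-+ (suc m) k)) (-‿cong (*-congˡ (lucasV-+ m k))) ⟩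
      a * (u (suc m) * v (suc k) + (u (suc (suc m)) - a * u (suc m)) * v k) - b * (u m * v (suc k) + (u (suc m) - a * u m) * v k)
        ≈⟨ step a b (u m) (u (suc m)) (v (suc k)) (v k) ⟩
      u (suc (suc m)) * v (suc k) + (u (suc (suc (suc m))) - a * u (suc (suc m))) * v k ∎
      where
      step : ∀ a b p q V₁ V₀ →
        a * (q * V₁ + ((a * q - b * p) - a * q) * V₀) - b * (p * V₁ + (q - a * p) * V₀) ≈
        (a * q - b * p) * V₁ + ((a * (a * q - b * p) - b * q) - a * (a * q - b * p)) * V₀
      step = solve 6 (λ a b p q V₁ V₀ →
        a :* (q :* V₁ :+ ((a :* q :- b :* p) :- a :* q) :* V₀) :- b :* (p :* V₁ :+ (q :- a :* p) :* V₀) :=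
        (a :* q :- b :* p) :* V₁ :+ ((a :* (a :* q :- b :* p) :- b :* q) :- a :* (a :* q :- b :* p)) :* V₀) refl

    lucasV≈lucasU : ∀ m → v m ≈ fromNat R 2 * u (suc m) - a * u m
    lucasV≈lucasU zero          = base a
      where
      base : ∀ a → 1# + 1# ≈ fromNat R 2 * 1# - a * 0#
      base = solve 1 (λ a → con (+ 1) :+ con (+ 1) := :fromNat 2 :* con (+ 1) :- a :* con (+ 0)) refl
    lucasV≈lucasU (suc zero)    = base a b
      where
      base : ∀ a b → a ≈ fromNat R 2 * (a * 1# - b * 0#) - a * 1#
      base = solve 2 (λ a b → a := :fromNat 2 :* (a :* con (+ 1) :- b :* con (+ 0)) :- a :* con (+ 1)) refl
    lucasV≈lucasU (suc (suc m)) = begin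
      a * v (suc m) - b * v m
        ≈⟨ +-cong (*-congˡ (lucasV≈lucasU (suc m))) (-‿cong (*-congˡ (lucasV≈lucasU m))) ⟩
      a * (fromNat R 2 * u (suc (suc m)) - a * u (suc m)) - b * (fromNat R 2 * u (suc m) - a * u m)
        ≈⟨ step a b (u m) (u (suc m)) ⟩
      fromNat R 2 * u (suc (suc (suc m))) - a * u (suc (suc m)) ∎
      where
      step : ∀ a b p q → a * (fromNat R 2 * (a * q - b * p) - a * q) - b * (fromNat R 2 * q - a * p) ≈
                         fromNat R 2 * (a * (a * q - b * p) - b * q) - a * (a * q - b * p)
      step = solve 4 (λ a b p q → a :* (:fromNat 2 :* (a :* q :- b :* p) :- a :* q) :- b :* (:fromNat 2 :* q :- a :* p) :=
                                  :fromNat 2 :* (a :* (a :* q :- b :* p) :- b :* q) :- a :* (a :* q :- b :* p)) refl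

    lucasU-cassini : ∀ m → u (suc m) * u (suc m) - a * u m * u (suc m) + b * (u m * u m) ≈ pow R b m
    lucasU-cassini zero    = base a b
      where
      base : ∀ a b → 1# * 1# - a * 0# * 1# + b * (0# * 0#) ≈ 1#
      base = solve 2 (λ a b → con (+ 1) :* con (+ 1) :- a :* con (+ 0) :* con (+ 1) :+ b :* (con (+ 0) :* con (+ 0)) := con (+ 1)) refl
    lucasU-cassini (suc m) = trans (step a b (u m) (u (suc m))) (*-congˡ (lucasU-cassini m))
      where
      step : ∀ a b p q → let r = a * q - b * p in
             r * r - a * q * r + b * (q * q) ≈ b * (q * q - a * p * q + b * (p * p))
      step = solve 4 (λ a b p q → let r = a :* q :- b :* p in
             r :* r :- a :* q :* r :+ b :* (q :* q) := b :* (q :* q :- a :* p :* q :+ b :* (p :* p))) refl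

module LucasHankel {c ℓ : Level} (R : CommutativeRing c ℓ) (A : CommutativeRing.Carrier R) where
  open CommutativeRing R hiding (zero)
  open IntegerCoefficientSolver R using (solve; _:=_; _:+_; _:*_; :-_; _:-_; con; :fromNat)
  open FiniteSums R
  open LucasSequences R
  open import Relation.Binary.Reasoning.Setoid setoid

  u v w : ℕ → Carrier
  u = lucasU R A (- 1#)
  v = lucasV R A (- 1#)
  w m = u (suc m) - A * u m

  next : Carrier → Carrier → Carrier
  next p q = A * q - (- 1#) * p

  -- Two steps at a time because of the alternating sign (-1)ᵐ in Cassini's identity.
  sumTo-closedForm : ∀ (t : ℕ → Carrier) (T : Carrier → Carrier → Carrier → Carrier) (S : Carrier → Carrier → Carrier) →
    (∀ m → t m ≈ T (u m) (u (suc m)) (u (suc (suc m)))) →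
    (∀ p q → S (next p q) (next q (next p q)) ≈ S p q + A * T p q (next p q) + A * T q (next p q) (next q (next p q))) →
    S 0# 1# ≈ 0# →
    ∀ k → A * sumTo (k ℕ.* 2) t ≈ S (u (k ℕ.* 2)) (u (suc (k ℕ.* 2)))
  sumTo-closedForm t T S t≈T step S₀≈0 k =
    trans (*-distribˡ-sumTo (k ℕ.* 2) A t)
          (sumTo-telescope₂ (λ m → A * t m) (λ m → S (u m) (u (suc m))) S₀≈0
             (λ m → trans (step (u m) (u (suc m))) (+-cong (+-congˡ (*-congˡ (sym (t≈T m)))) (*-congˡ (sym (t≈T (suc m))))))
             k)

  S₁ S₂ S₃ : Carrier → Carrier → Carrier
  S₁ p q = (- A) * (p * p) + fromNat R 2 * (p * q)
  S₂ p q = (- (A * (A * A + fromNat R 3))) * (p * p) + (A * A + fromNat R 2) * (p * q)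
  S₃ p q = (A * A + fromNat R 2) * (p * p) - A * (p * q)

  S₃-base : S₃ 0# 1# ≈ 0#
  S₃-base = solve 1 (λ A → (A :* A :+ :fromNat 2) :* (con (+ 0) :* con (+ 0)) :- A :* (con (+ 0) :* con (+ 1)) := con (+ 0)) refl A

  sum-u*vsuc : ∀ k → A * sumTo (k ℕ.* 2) (λ m → u m * v (suc m)) ≈ S₁ (u (k ℕ.* 2)) (u (suc (k ℕ.* 2)))
  sum-u*vsuc = sumTo-closedForm _ T S₁ (λ m → *-congˡ (lucasV≈lucasU A (- 1#) (suc m))) step base
    where
    T : Carrier → Carrier → Carrier → Carrier
    T p q r = p * (fromNat R 2 * r - A * q)
    step : ∀ p q → S₁ (next p q) (next q (next p q)) ≈ S₁ p q + A * T p q (next p q) + A * T q (next p q) (next q (next p q))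
    step = solve 3 (λ A p q → let r = A :* q :- (:- con (+ 1)) :* p ; s = A :* r :- (:- con (+ 1)) :* q in
      (:- A) :* (r :* r) :+ :fromNat 2 :* (r :* s) :=
      (:- A) :* (p :* p) :+ :fromNat 2 :* (p :* q) :+ A :* (p :* (:fromNat 2 :* r :- A :* q))
        :+ A :* (q :* (:fromNat 2 :* s :- A :* r))) refl A
    base : S₁ 0# 1# ≈ 0#
    base = solve 1 (λ A → (:- A) :* (con (+ 0) :* con (+ 0)) :+ :fromNat 2 :* (con (+ 0) :* con (+ 1)) := con (+ 0)) refl A

  sum-w*v : ∀ k → A * sumTo (k ℕ.* 2) (λ m → w m * v m) ≈ S₂ (u (k ℕ.* 2)) (u (suc (k ℕ.* 2)))
  sum-w*v = sumTo-closedForm _ T S₂ (λ m → *-congˡ (lucasV≈lucasU A (- 1#) m)) step base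
    where
    T : Carrier → Carrier → Carrier → Carrier
    T p q r = (q - A * p) * (fromNat R 2 * q - A * p)
    step : ∀ p q → S₂ (next p q) (next q (next p q)) ≈ S₂ p q + A * T p q (next p q) + A * T q (next p q) (next q (next p q))
    step = solve 3 (λ A p q → let r = A :* q :- (:- con (+ 1)) :* p ; s = A :* r :- (:- con (+ 1)) :* q in
      (:- (A :* (A :* A :+ :fromNat 3))) :* (r :* r) :+ (A :* A :+ :fromNat 2) :* (r :* s) :=
      (:- (A :* (A :* A :+ :fromNat 3))) :* (p :* p) :+ (A :* A :+ :fromNat 2) :* (p :* q)
        :+ A :* ((q :- A :* p) :* (:fromNat 2 :* q :- A :* p)) :+ A :* ((r :- A :* q) :* (:fromNat 2 :* r :- A :* q))) refl A
    base : S₂ 0# 1# ≈ 0#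
    base = solve 1 (λ A → (:- (A :* (A :* A :+ :fromNat 3))) :* (con (+ 0) :* con (+ 0))
                          :+ (A :* A :+ :fromNat 2) :* (con (+ 0) :* con (+ 1)) := con (+ 0)) refl A

  sum-u*v : ∀ k → A * sumTo (k ℕ.* 2) (λ m → u m * v m) ≈ S₃ (u (k ℕ.* 2)) (u (suc (k ℕ.* 2)))
  sum-u*v = sumTo-closedForm _ T S₃ (λ m → *-congˡ (lucasV≈lucasU A (- 1#) m)) step S₃-base
    where
    T : Carrier → Carrier → Carrier → Carrier
    T p q r = p * (fromNat R 2 * q - A * p)
    step : ∀ p q → S₃ (next p q) (next q (next p q)) ≈ S₃ p q + A * T p q (next p q) + A * T q (next p q) (next q (next p q))
    step = solve 3 (λ A p q → let r = A :* q :- (:- con (+ 1)) :* p ; s = A :* r :- (:- con (+ 1)) :* q in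
      (A :* A :+ :fromNat 2) :* (r :* r) :- A :* (r :* s) :=
      (A :* A :+ :fromNat 2) :* (p :* p) :- A :* (p :* q) :+ A :* (p :* (:fromNat 2 :* q :- A :* p))
        :+ A :* (q :* (:fromNat 2 :* r :- A :* q))) refl A

  sum-w*vsuc : ∀ k → A * sumTo (k ℕ.* 2) (λ m → w m * v (suc m)) ≈ S₃ (u (k ℕ.* 2)) (u (suc (k ℕ.* 2)))
  sum-w*vsuc = sumTo-closedForm _ T S₃ (λ m → *-congˡ (lucasV≈lucasU A (- 1#) (suc m))) step S₃-base
    where
    T : Carrier → Carrier → Carrier → Carrier
    T p q r = (q - A * p) * (fromNat R 2 * r - A * q)
    step : ∀ p q → S₃ (next p q) (next q (next p q)) ≈ S₃ p q + A * T p q (next p q) + A * T q (next p q) (next q (next p q))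
    step = solve 3 (λ A p q → let r = A :* q :- (:- con (+ 1)) :* p ; s = A :* r :- (:- con (+ 1)) :* q in
      (A :* A :+ :fromNat 2) :* (r :* r) :- A :* (r :* s) :=
      (A :* A :+ :fromNat 2) :* (p :* p) :- A :* (p :* q)
        :+ A :* ((q :- A :* p) :* (:fromNat 2 :* r :- A :* q)) :+ A :* ((r :- A :* q) :* (:fromNat 2 :* s :- A :* r))) refl A

  pow-neg1-even : ∀ k → pow R (- 1#) (k ℕ.* 2) ≈ 1#
  pow-neg1-even zero    = refl
  pow-neg1-even (suc k) = trans (square (pow R (- 1#) (k ℕ.* 2))) (pow-neg1-even k)
    where
    square : ∀ X → (- 1#) * ((- 1#) * X) ≈ X
    square = solve 1 (λ X → (:- con (+ 1)) :* ((:- con (+ 1)) :* X) := X) refl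

  det-xI-lucasHankel : ∀ x n →
    let a = sumTo n (λ m → u m * v (suc m)) ; b = sumTo n (λ m → w m * v m)
        c′ = sumTo n (λ m → u m * v m)       ; d = sumTo n (λ m → w m * v (suc m)) in
    det R n (λ i j → x * δ R i j - v (toℕ i +ℕ toℕ j)) ≈
    pow R x n - (a + b) * pow R x (n ∸ 1) + (a * b - c′ * d) * pow R x (n ∸ 2)
  det-xI-lucasHankel x n = begin
    det R n (λ i j → x * δ R i j - v (toℕ i +ℕ toℕ j))
      ≈⟨ det-cong n {λ i j → x * δ R i j - v (toℕ i +ℕ toℕ j)} {scalarMinusRankTwo U V W Z}
                  (λ i j → +-congˡ (-‿cong (lucasV-+ A (- 1#) (toℕ i) (toℕ j)))) ⟩
    det R n (scalarMinusRankTwo U V W Z)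
      ≈⟨ det-scalarMinusRankTwo n U V W Z ⟩
    pow R x n - (U · V + W · Z) * pow R x (n ∸ 1) + ((U · V) * (W · Z) - (U · Z) * (W · V)) * pow R x (n ∸ 2)
      ≈⟨ +-cong (+-congˡ (-‿cong (*-congʳ (+-cong (toSumTo _) (toSumTo _)))))
                (*-congʳ (+-cong (*-cong (toSumTo _) (toSumTo _)) (-‿cong (*-cong (toSumTo _) (toSumTo _))))) ⟩
    _ ∎
    where
    open Determinants R
    open RankTwoPerturbation R x
    U V W Z : Vector Carrier n
    U i = u (toℕ i)
    V i = v (suc (toℕ i))
    W i = w (toℕ i)
    Z i = v (toℕ i)
    toSumTo : ∀ t → sumFin R n (t ∘ toℕ) ≈ sumTo n t
    toSumTo = sumFin-toℕ n

  det-xI-lucasHankel-even : ∀ x k → let n = suc k ℕ.* 2 in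
    (A * A) * det R n (λ i j → x * δ R i j - v (toℕ i +ℕ toℕ j)) ≈
    ((A * A) * pow R x n - (A * (A * A + fromNat R 4)) * (u n * u (n ∸ 1)) * pow R x (n ∸ 1))
      + (A * A + fromNat R 4) * (u n * u n) * pow R x (n ∸ 2)
  det-xI-lucasHankel-even x k = begin
    (A * A) * det R n (λ i j → x * δ R i j - v (toℕ i +ℕ toℕ j))
      ≈⟨ *-congˡ (det-xI-lucasHankel x n) ⟩
    (A * A) * (X - (a + b) * X₁ + (a * b - c′ * d) * X₂)
      ≈⟨ scale A a b c′ d X X₁ X₂ ⟩
    A * A * X - A * (A * a + A * b) * X₁ + ((A * a) * (A * b) - (A * c′) * (A * d)) * X₂
      ≈⟨ +-cong (+-congˡ (-‿cong (*-congʳ (*-congˡ (+-cong Aa Ab)))))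
                (*-congʳ (+-cong (*-cong Aa Ab) (-‿cong (*-cong Ac Ad)))) ⟩
    A * A * X - A * (S₁ p q + S₂ p q) * X₁ + (S₁ p q * S₂ p q - S₃ p q * S₃ p q) * X₂
      ≈⟨ expand p y X X₁ X₂ ⟩
    (A * A * X - A * (A * A + fromNat R 4) * (p * y) * X₁)
      + (A * A + fromNat R 4) * (p * p) * (q * q - A * p * q + (- 1#) * (p * p)) * X₂
      ≈⟨ +-congˡ (*-congʳ (trans (*-congˡ (trans (lucasU-cassini A (- 1#) n) (pow-neg1-even (suc k)))) (*-identityʳ _))) ⟩
    (A * A * X - A * (A * A + fromNat R 4) * (p * y) * X₁) + (A * A + fromNat R 4) * (p * p) * X₂ ∎
    where
    n : ℕ
    n = suc k ℕ.* 2
    a b c′ d X X₁ X₂ p q y : Carrier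
    a  = sumTo n (λ m → u m * v (suc m))
    b  = sumTo n (λ m → w m * v m)
    c′ = sumTo n (λ m → u m * v m)
    d  = sumTo n (λ m → w m * v (suc m))
    X  = pow R x n
    X₁ = pow R x (n ∸ 1)
    X₂ = pow R x (n ∸ 2)
    p  = u n
    q  = u (suc n)
    y  = u (n ∸ 1)
    Aa : A * a ≈ S₁ p q
    Aa = sum-u*vsuc (suc k)
    Ab : A * b ≈ S₂ p q
    Ab = sum-w*v (suc k)
    Ac : A * c′ ≈ S₃ p q
    Ac = sum-u*v (suc k)
    Ad : A * d ≈ S₃ p q
    Ad = sum-w*vsuc (suc k)
    scale : ∀ A a b c d X X₁ X₂ → (A * A) * (X - (a + b) * X₁ + (a * b - c * d) * X₂) ≈
            A * A * X - A * (A * a + A * b) * X₁ + ((A * a) * (A * b) - (A * c) * (A * d)) * X₂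
    scale = solve 8 (λ A a b c d X X₁ X₂ → (A :* A) :* (X :- (a :+ b) :* X₁ :+ (a :* b :- c :* d) :* X₂) :=
            A :* A :* X :- A :* (A :* a :+ A :* b) :* X₁ :+ ((A :* a) :* (A :* b) :- (A :* c) :* (A :* d)) :* X₂) refl
    expand : ∀ p y X X₁ X₂ → let q = next y p in
      A * A * X - A * (S₁ p q + S₂ p q) * X₁ + (S₁ p q * S₂ p q - S₃ p q * S₃ p q) * X₂ ≈
      (A * A * X - A * (A * A + fromNat R 4) * (p * y) * X₁)
        + (A * A + fromNat R 4) * (p * p) * (q * q - A * p * q + (- 1#) * (p * p)) * X₂
    expand = solve 6 (λ A p y X X₁ X₂ →
      let q  = A :* p :- (:- con (+ 1)) :* y
          s₁ = (:- A) :* (p :* p) :+ :fromNat 2 :* (p :* q)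
          s₂ = (:- (A :* (A :* A :+ :fromNat 3))) :* (p :* p) :+ (A :* A :+ :fromNat 2) :* (p :* q)
          s₃ = (A :* A :+ :fromNat 2) :* (p :* p) :- A :* (p :* q)
      in A :* A :* X :- A :* (s₁ :+ s₂) :* X₁ :+ (s₁ :* s₂ :- s₃ :* s₃) :* X₂ :=
         (A :* A :* X :- A :* (A :* A :+ :fromNat 4) :* (p :* y) :* X₁)
           :+ (A :* A :+ :fromNat 4) :* (p :* p) :* (q :* q :- A :* p :* q :+ (:- con (+ 1)) :* (p :* p)) :* X₂) refl A

corollary1p14 : {c ℓ : Level} (R : CommutativeRing c ℓ) →
    let open CommutativeRing R in
    (A x : Carrier) → ¬ (A * (A * A + fromNat R 4) ≈ 0#) →
    (n : ℕ) → 1 ≤ n → 2 ∣ n →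
    (A * A) * det R n (λ j k → x * δ R j k - lucasV R A (- 1#) (toℕ j +ℕ toℕ k))
      ≈ ((A * A) * pow R x n
         - (A * (A * A + fromNat R 4)) * (lucasU R A (- 1#) n * lucasU R A (- 1#) (n ∸ 1)) * pow R x (n ∸ 1))
        + (A * A + fromNat R 4) * (lucasU R A (- 1#) n * lucasU R A (- 1#) n) * pow R x (n ∸ 2)
corollary1p14 R A x _ .(zero ℕ.* 2)  ()  (divides zero    ≡.refl)
corollary1p14 R A x _ .(suc k ℕ.* 2) _   (divides (suc k) ≡.refl) = LucasHankel.det-xI-lucasHankel-even R A x k
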